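{- For every integer $m\ge 2$ and every positive integer $k$, $$\chi_{B_m^1}(2k+1)=\Big[\sum_{i=0}^{m-2}(-1)^i(2k)^{(m-2)-i}\Big]\chi_{C_2^- }(2k+1)=\sum_{i=0}^{m-2}(-1)^i(2k)^{m-i}.$$
   Context: A signed graph $(G,\sigma)$ is a finite graph $G$ (parallel edges allowed) with a sign function $\sigma:E(G)\to\{+1,-1\}$. A signed coloring in $2k+1$ colors is a map $c:V(G)\to\{ -k,\dots,k\}$; it is proper if $c(y)\neq\sigma(e)c(x)$ for every edge $e=xy$. The signed chromatic polynomial $\chi_{(G,\sigma)}(2k+1)$ is the number of proper signed colorings in $2k+1$ colors. $C_2^-$ is the signed graph on two vertices $u,v$ joined by two parallel edges, one positive and one negative. For $m\ge 3$, $B_m^1$ is the signed graph consisting of $C_2^-$ on $u,v$ together with a path $u\,u_1\,u_2\cdots u_{m-2}\,v$ of positive edges through $m-2$ new vertices (i.e. an $m$-cycle whose edge $uv$ is replaced by a positive and a negative parallel edge). By convention $B_2^1:=C_2^-$. -}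

module Defs where

open import Data.Nat using (ℕ; zero; suc; _+_; _*_)
open import Data.Integer as ℤ using (ℤ; +_; -_; _-_)
open import Data.Fin using (Fin; zero; suc)
open import Data.Vec using (Vec; []; _∷_; lookup)
open import Data.List using (List; []; _∷_; _++_; map; concatMap; length; filterᵇ; allFin; upTo; foldr)
open import Data.Product using (_×_; _,_)
open import Data.Bool using (Bool; not; _∧_; true)
open import Relation.Nullary using (does)

data Sign : Set where
  pos neg : Sign

act : Sign → ℤ → ℤ
act pos c = c
act neg c = - c

-- An edge e = xy with sign σ(e), on vertex set Fin n (parallel edges allowed: edges form a list)
record Edge (n : ℕ) : Set where
  constructor edge
  field
    src : Fin n
    tgt : Fin n
    sgn : Sign

record SignedGraph : Set where
  constructor mkSG
  field
    nV    : ℕ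
    edges : List (Edge nV)

open SignedGraph public

colours : ℕ → List ℤ
colours k = map (λ i → (+ i) - (+ k)) (upTo (suc (2 * k)))

-- All maps Fin n → (given list of values), represented as vectors
allVecs : {A : Set} → List A → (n : ℕ) → List (Vec A n)
allVecs xs zero = [] ∷ []
allVecs xs (suc n) = concatMap (λ x → map (x ∷_) (allVecs xs n)) xs

properᵇ : (G : SignedGraph) → Vec ℤ (nV G) → Bool
properᵇ G c = foldr (λ e b → b ∧ ( not (does (lookup c (Edge.tgt e) ℤ.≟ act (Edge.sgn e) (lookup c (Edge.src e)))))) true (edges G)

-- Signed chromatic polynomial evaluated at 2k+1: number of proper signed colourings in 2k+1 colours
χ[_]⟨2*_+1⟩ : SignedGraph → ℕ → ℕ
χ[ G ]⟨2* k +1⟩ = length (filterᵇ (properᵇ G) (allVecs (colours k) (nV G)))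

C2⁻ : SignedGraph
C2⁻ = mkSG 2 (edge zero (suc zero) pos ∷ edge zero (suc zero) neg ∷ [])

pathEdges : {n : ℕ} → List (Fin n) → List (Edge n)
pathEdges [] = []
pathEdges (x ∷ []) = []
pathEdges (x ∷ y ∷ ys) = edge x y pos ∷ pathEdges (y ∷ ys)

-- B^1_{j+2}: vertices u = 0, v = 1, u₁ … u_j = 2 … j+1;
-- C₂⁻ on u,v plus positive path u u₁ … u_j v.  By convention B^1_2 = C₂⁻.
B¹ : ℕ → SignedGraph
B¹ zero = C2⁻
B¹ (suc j) = mkSG (suc (suc (suc j)))
  (edge zero (suc zero) pos ∷ edge zero (suc zero) neg ∷
   pathEdges (zero ∷ (map (λ i → suc (suc i)) (allFin (suc j)) ++ (suc zero ∷ []))))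

Σ[i≤_]_ : ℕ → (ℕ → ℤ) → ℤ
Σ[i≤ n ] f = foldr (λ i acc → f i ℤ.+ acc) (+ 0) (upTo (suc n))

module Submission where

-- Colour the two ends u, v of B¹ₘ by a, b.  The remaining
-- conditions say that the positive path u u₁ … v is a proper walk from a
-- to b, i.e. consecutive colours differ.  For a duplicate-free palette of
-- q colours, the number of proper walks with n interior vertices is
--     alt (q - 1) n - (-1)ⁿ [a = b],   alt p n = Σ_{i ≤ n} (-1)ⁱ pⁿ⁻ⁱ,
-- by induction on n (remove the first interior vertex).  Every colouring
-- of the C₂⁻ part has a ≠ b, so χ(B¹) = alt (2k) n · χ(C₂⁻), and
-- χ(C₂⁻) = (2k)² counts pairs with b ∉ {a, -a}.  Multiplying alt (2k) n by
-- (2k)² shifts the exponents by two, which is the second identity.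

open import Defs
open import Data.Nat using (ℕ; zero; suc; _≤_; _∸_; s≤s; z≤n)
import Data.Nat as ℕ
import Data.Nat.Properties as ℕP
open import Data.Integer using (ℤ; +_; -[1+_]; _*_; _^_; _+_; _-_; -_; _⊖_; _≟_)
import Data.Integer.Properties as ℤP
import Data.Integer.Tactic.RingSolver as ℤSolver
open import Data.Bool using (Bool; true; false; not; _∧_)
open import Data.Bool.Properties using (∧-assoc; ∧-zeroʳ)
open import Data.Fin using (Fin; zero; suc)
open import Data.Vec using (Vec; []; _∷_; lookup; toList)
open import Data.List
  using (List; []; _∷_; _++_; map; concatMap; length; filterᵇ; foldr; upTo; allFin; tabulate)
import Data.List.Properties as ListP
open import Data.List.Membership.Propositional using (_∈_)
open import Data.List.Membership.Propositional.Properties using (∈-map⁺; ∈-map⁻; ∈-upTo⁺; ∈-upTo⁻)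
open import Data.List.Relation.Unary.Any using (here; there)
open import Data.List.Relation.Unary.All using (All; []; _∷_)
import Data.List.Relation.Unary.All as All
open import Data.List.Relation.Unary.Unique.Propositional using (Unique; _∷_)
import Data.List.Relation.Unary.Unique.Propositional.Properties as UniqueP
open import Data.Product using (_×_; _,_)
open import Function using (_∘_)
open import Relation.Nullary using (does; yes; no)
open import Relation.Nullary.Decidable using (dec-true; dec-false)
open import Relation.Binary.PropositionalEquality
  using (_≡_; _≢_; refl; sym; trans; cong; cong₂; subst; module ≡-Reasoning)

open ≡-Reasoning

private variable
  A B : Set

-- Σ⟨ xs ⟩ f = Σ_{x ∈ xs} f x.  On xs = upTo (suc n) it unfolds to Σ[i≤ n ] f.
Σ⟨_⟩ : List A → (A → ℤ) → ℤ
Σ⟨ xs ⟩ f = foldr (λ x acc → f x + acc) (+ 0) xs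

Σ-++ : (xs ys : List A) (f : A → ℤ) → Σ⟨ xs ++ ys ⟩ f ≡ Σ⟨ xs ⟩ f + Σ⟨ ys ⟩ f
Σ-++ []       ys f = sym (ℤP.+-identityˡ _)
Σ-++ (x ∷ xs) ys f = trans (cong (_+_ (f x)) (Σ-++ xs ys f)) (sym (ℤP.+-assoc (f x) _ _))

Σ-map : (g : A → B) (xs : List A) (f : B → ℤ) → Σ⟨ map g xs ⟩ f ≡ Σ⟨ xs ⟩ (f ∘ g)
Σ-map g []       f = refl
Σ-map g (x ∷ xs) f = cong (_+_ (f (g x))) (Σ-map g xs f)

Σ-concatMap : (g : A → List B) (xs : List A) (f : B → ℤ) →
            Σ⟨ concatMap g xs ⟩ f ≡ Σ⟨ xs ⟩ (λ x → Σ⟨ g x ⟩ f)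
Σ-concatMap g []       f = refl
Σ-concatMap g (x ∷ xs) f =
  trans (Σ-++ (g x) _ f) (cong (_+_ (Σ⟨ g x ⟩ f)) (Σ-concatMap g xs f))

Σ-cong : (xs : List A) {f g : A → ℤ} → (∀ {x} → x ∈ xs → f x ≡ g x) → Σ⟨ xs ⟩ f ≡ Σ⟨ xs ⟩ g
Σ-cong []       eq = refl
Σ-cong (x ∷ xs) eq = cong₂ _+_ (eq (here refl)) (Σ-cong xs (eq ∘ there))

Σ-- : (xs : List A) (f g : A → ℤ) → Σ⟨ xs ⟩ (λ x → f x - g x) ≡ Σ⟨ xs ⟩ f - Σ⟨ xs ⟩ g
Σ-- []       f g = refl
Σ-- (x ∷ xs) f g = trans (cong (_+_ (f x - g x)) (Σ-- xs f g)) (regroup (f x) (g x) _ _)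
  where
  regroup : ∀ a b c d → (a - b) + (c - d) ≡ (a + c) - (b + d)
  regroup = ℤSolver.solve-∀

Σ-*ˡ : (xs : List A) (c : ℤ) (f : A → ℤ) → Σ⟨ xs ⟩ (λ x → c * f x) ≡ c * Σ⟨ xs ⟩ f
Σ-*ˡ []       c f = sym (ℤP.*-zeroʳ c)
Σ-*ˡ (x ∷ xs) c f =
  trans (cong (_+_ (c * f x)) (Σ-*ˡ xs c f)) (sym (ℤP.*-distribˡ-+ c (f x) _))

Σ-*ʳ : (xs : List A) (f : A → ℤ) (c : ℤ) → Σ⟨ xs ⟩ (λ x → f x * c) ≡ Σ⟨ xs ⟩ f * c
Σ-*ʳ []       f c = refl
Σ-*ʳ (x ∷ xs) f c =
  trans (cong (_+_ (f x * c)) (Σ-*ʳ xs f c)) (sym (ℤP.*-distribʳ-+ c (f x) _))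

Σ-const : (xs : List A) (c : ℤ) → Σ⟨ xs ⟩ (λ _ → c) ≡ + length xs * c
Σ-const []       c = refl
Σ-const (x ∷ xs) c = trans (cong (_+_ c) (Σ-const xs c)) (one-more c (+ length xs))
  where
  one-more : ∀ c n → c + n * c ≡ (+ 1 + n) * c
  one-more = ℤSolver.solve-∀

Σ-upTo-suc : (m : ℕ) (f : ℕ → ℤ) → Σ⟨ upTo (suc m) ⟩ f ≡ Σ⟨ upTo m ⟩ f + f m
Σ-upTo-suc m f = begin
  Σ⟨ upTo (suc m) ⟩ f          ≡⟨ cong (λ xs → Σ⟨ xs ⟩ f) (sym (ListP.upTo-∷ʳ m)) ⟩
  Σ⟨ upTo m ++ m ∷ [] ⟩ f      ≡⟨ Σ-++ (upTo m) (m ∷ []) f ⟩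
  Σ⟨ upTo m ⟩ f + (f m + + 0)  ≡⟨ cong (_+_ (Σ⟨ upTo m ⟩ f)) (ℤP.+-identityʳ (f m)) ⟩
  Σ⟨ upTo m ⟩ f + f m          ∎

⟦_⟧ : Bool → ℤ
⟦ true  ⟧ = + 1
⟦ false ⟧ = + 0

⟦∧⟧ : (b c : Bool) → ⟦ b ∧ c ⟧ ≡ ⟦ b ⟧ * ⟦ c ⟧
⟦∧⟧ true  true  = refl
⟦∧⟧ true  false = refl
⟦∧⟧ false c     = refl

⟦not⟧ : (b : Bool) → ⟦ not b ⟧ ≡ + 1 - ⟦ b ⟧
⟦not⟧ true  = refl
⟦not⟧ false = refl

count-Σ : (p : A → Bool) (xs : List A) → + length (filterᵇ p xs) ≡ Σ⟨ xs ⟩ (λ x → ⟦ p x ⟧)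
count-Σ p []       = refl
count-Σ p (x ∷ xs) with p x
... | true  = cong (_+_ (+ 1)) (count-Σ p xs)
... | false = trans (count-Σ p xs) (sym (ℤP.+-identityˡ _))

Σ-allVecs : (xs : List A) (n : ℕ) (f : Vec A (suc n) → ℤ) →
            Σ⟨ allVecs xs (suc n) ⟩ f ≡ Σ⟨ xs ⟩ (λ x → Σ⟨ allVecs xs n ⟩ (λ r → f (x ∷ r)))
Σ-allVecs xs n f =
  trans (Σ-concatMap _ xs f) (Σ-cong xs (λ {x} _ → Σ-map (x ∷_) (allVecs xs n) f))

count-by-first-two : (xs : List A) {n : ℕ} (p : Vec A (suc (suc n)) → Bool) →
  + length (filterᵇ p (allVecs xs (suc (suc n))))
    ≡ Σ⟨ xs ⟩ (λ a → Σ⟨ xs ⟩ (λ b → Σ⟨ allVecs xs n ⟩ (λ r → ⟦ p (a ∷ b ∷ r) ⟧)))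
count-by-first-two xs {n} p =
  trans (count-Σ p (allVecs xs (suc (suc n))))
    (trans (Σ-allVecs xs (suc n) (λ v → ⟦ p v ⟧))
      (Σ-cong xs (λ {a} _ → Σ-allVecs xs n (λ r → ⟦ p (a ∷ r) ⟧))))

infix 4 _≢ᵇ_
_≢ᵇ_ : ℤ → ℤ → Bool
x ≢ᵇ y = not (does (x ≟ y))

δ : ℤ → ℤ → ℤ
δ x y = ⟦ does (x ≟ y) ⟧

ν : ℤ → ℤ → ℤ
ν x y = ⟦ x ≢ᵇ y ⟧

δ-refl : (x : ℤ) → δ x x ≡ + 1
δ-refl x = cong ⟦_⟧ (dec-true (x ≟ x) refl)

δ-≢ : {x y : ℤ} → x ≢ y → δ x y ≡ + 0
δ-≢ {x} {y} x≢y = cong ⟦_⟧ (dec-false (x ≟ y) x≢y)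

δ-sym : (x y : ℤ) → δ x y ≡ δ y x
δ-sym x y with x ≟ y
... | yes refl = sym (δ-refl x)
... | no x≢y   = sym (δ-≢ (x≢y ∘ sym))

ν≡1-δ : (x y : ℤ) → ν x y ≡ + 1 - δ x y
ν≡1-δ x y = ⟦not⟧ (does (x ≟ y))

Σ-δ-absent : {xs : List ℤ} {a : ℤ} → All (_≢ a) xs → (F : ℤ → ℤ) →
             Σ⟨ xs ⟩ (λ x → F x * δ x a) ≡ + 0
Σ-δ-absent []            F = refl
Σ-δ-absent {x ∷ _} (x≢a ∷ rest) F =
  cong₂ _+_ (trans (cong (F x *_) (δ-≢ x≢a)) (ℤP.*-zeroʳ (F x))) (Σ-δ-absent rest F)

Σ-δ : {xs : List ℤ} {a : ℤ} → Unique xs → a ∈ xs → (F : ℤ → ℤ) →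
      Σ⟨ xs ⟩ (λ x → F x * δ x a) ≡ F a
Σ-δ {y ∷ ys} (y∉ys ∷ _) (here refl) F = begin
  F y * δ y y + Σ⟨ ys ⟩ (λ x → F x * δ x y)
    ≡⟨ cong₂ _+_ (cong (F y *_) (δ-refl y)) (Σ-δ-absent (All.map (_∘ sym) y∉ys) F) ⟩
  F y * + 1 + + 0
    ≡⟨ trans (ℤP.+-identityʳ _) (ℤP.*-identityʳ (F y)) ⟩
  F y ∎
Σ-δ {y ∷ ys} (y∉ys ∷ distinct) (there a∈ys) F = begin
  F y * δ y _ + Σ⟨ ys ⟩ (λ x → F x * δ x _)
    ≡⟨ cong₂ _+_ (cong (F y *_) (δ-≢ (All.lookup y∉ys a∈ys))) (Σ-δ distinct a∈ys F) ⟩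
  F y * + 0 + F _
    ≡⟨ cong (_+ F _) (ℤP.*-zeroʳ (F y)) ⟩
  + 0 + F _
    ≡⟨ ℤP.+-identityˡ _ ⟩
  F _ ∎

Σ-ν : {xs : List ℤ} {a : ℤ} → Unique xs → a ∈ xs → (F : ℤ → ℤ) →
      Σ⟨ xs ⟩ (λ x → F x * ν x a) ≡ Σ⟨ xs ⟩ F - F a
Σ-ν {xs} {a} distinct a∈xs F = begin
  Σ⟨ xs ⟩ (λ x → F x * ν x a)         ≡⟨ Σ-cong xs (λ {x} _ → ν-expand x) ⟩
  Σ⟨ xs ⟩ (λ x → F x - F x * δ x a)   ≡⟨ Σ-- xs F (λ x → F x * δ x a) ⟩
  Σ⟨ xs ⟩ F - Σ⟨ xs ⟩ (λ x → F x * δ x a) ≡⟨ cong (_-_ (Σ⟨ xs ⟩ F)) (Σ-δ distinct a∈xs F) ⟩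
  Σ⟨ xs ⟩ F - F a                      ∎
  where
  distrib : ∀ f d → f * (+ 1 - d) ≡ f - f * d
  distrib = ℤSolver.solve-∀
  ν-expand : ∀ x → F x * ν x a ≡ F x - F x * δ x a
  ν-expand x = trans (cong (F x *_) (ν≡1-δ x a)) (distrib (F x) (δ x a))

ν-count : {xs : List ℤ} {c : ℤ} → Unique xs → c ∈ xs → Σ⟨ xs ⟩ (λ x → ν x c) ≡ + length xs - + 1
ν-count {xs} {c} distinct c∈xs = begin
  Σ⟨ xs ⟩ (λ x → ν x c)              ≡⟨ Σ-cong xs (λ {x} _ → sym (ℤP.*-identityˡ (ν x c))) ⟩
  Σ⟨ xs ⟩ (λ x → + 1 * ν x c)        ≡⟨ Σ-ν distinct c∈xs (λ _ → + 1) ⟩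
  Σ⟨ xs ⟩ (λ _ → + 1) - + 1          ≡⟨ cong (_- + 1) (trans (Σ-const xs (+ 1)) (ℤP.*-identityʳ (+ length xs))) ⟩
  + length xs - + 1                  ∎

sgn : ℕ → ℤ
sgn i = -[1+ 0 ] ^ i

alt : ℤ → ℕ → ℤ
alt p n = Σ[i≤ n ] (λ i → sgn i * p ^ (n ∸ i))

alt-scale : (p : ℤ) (n d : ℕ) → alt p n * p ^ d ≡ Σ[i≤ n ] (λ i → sgn i * p ^ (d ℕ.+ n ∸ i))
alt-scale p n d = trans (sym (Σ-*ʳ (upTo (suc n)) (λ i → sgn i * p ^ (n ∸ i)) (p ^ d)))
                        (Σ-cong (upTo (suc n)) (λ i∈ → raise (ℕP.≤-pred (∈-upTo⁻ i∈))))
  where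
  reassoc : ∀ s x y → s * x * y ≡ s * (y * x)
  reassoc = ℤSolver.solve-∀
  raise : ∀ {i} → i ≤ n → sgn i * p ^ (n ∸ i) * p ^ d ≡ sgn i * p ^ (d ℕ.+ n ∸ i)
  raise {i} i≤n = begin
    sgn i * p ^ (n ∸ i) * p ^ d      ≡⟨ reassoc (sgn i) _ _ ⟩
    sgn i * (p ^ d * p ^ (n ∸ i))    ≡⟨ cong (sgn i *_) (sym (ℤP.^-distribˡ-+-* p d (n ∸ i))) ⟩
    sgn i * p ^ (d ℕ.+ (n ∸ i))      ≡⟨ cong (λ e → sgn i * p ^ e) (sym (ℕP.+-∸-assoc d i≤n)) ⟩
    sgn i * p ^ (d ℕ.+ n ∸ i)        ∎

alt-suc : (p : ℤ) (n : ℕ) → alt p (suc n) ≡ alt p n * p + sgn (suc n)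
alt-suc p n = begin
  alt p (suc n)
    ≡⟨ Σ-upTo-suc (suc n) (λ i → sgn i * p ^ (suc n ∸ i)) ⟩
  Σ[i≤ n ] (λ i → sgn i * p ^ (suc n ∸ i)) + sgn (suc n) * p ^ (suc n ∸ suc n)
    ≡⟨ cong₂ _+_ (sym (alt-scale p n 1)) (cong (λ e → sgn (suc n) * p ^ e) (ℕP.n∸n≡0 n)) ⟩
  alt p n * p ^ 1 + sgn (suc n) * + 1
    ≡⟨ cong₂ _+_ (cong (alt p n *_) (ℤP.^-identityʳ p)) (ℤP.*-identityʳ (sgn (suc n))) ⟩
  alt p n * p + sgn (suc n) ∎

pathᵇ : List ℤ → Bool
pathᵇ []           = true
pathᵇ (x ∷ [])     = true
pathᵇ (x ∷ y ∷ ys) = pathᵇ (y ∷ ys) ∧ (y ≢ᵇ x)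

-- The walk from a through the interior colours r to b.  Note that
-- walkᵇ a (x ∷ r) b reduces to walkᵇ x r b ∧ (x ≢ᵇ a).
walkᵇ : {n : ℕ} → ℤ → Vec ℤ n → ℤ → Bool
walkᵇ a r b = pathᵇ (a ∷ toList r ++ b ∷ [])

endsᵇ : ℤ → ℤ → Bool
endsᵇ a b = (b ≢ᵇ - a) ∧ (b ≢ᵇ a)

δ-ends : (a b : ℤ) → δ a b * ⟦ endsᵇ a b ⟧ ≡ + 0
δ-ends a b with a ≟ b
... | yes refl = trans (cong (+ 1 *_) ends-self) (ℤP.*-zeroʳ (+ 1))
  where
  ends-self : ⟦ endsᵇ a a ⟧ ≡ + 0
  ends-self = cong ⟦_⟧ (trans (cong (λ d → (a ≢ᵇ - a) ∧ not d) (dec-true (a ≟ a) refl))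
                              (∧-zeroʳ (a ≢ᵇ - a)))
... | no _ = refl

ν-self-neg : (a : ℤ) → ν a (- a) ≡ ν a (+ 0)
ν-self-neg (+ zero)  = refl
ν-self-neg (+ suc n) = refl
ν-self-neg -[1+ n ]  = refl

module Palette (cs : List ℤ) (distinct : Unique cs) where

  q : ℤ
  q = + length cs

  walks : ℕ → ℤ → ℤ → ℤ
  walks n a b = Σ⟨ allVecs cs n ⟩ (λ r → ⟦ walkᵇ a r b ⟧)

  walks-suc : (n : ℕ) (a b : ℤ) → walks (suc n) a b ≡ Σ⟨ cs ⟩ (λ x → walks n x b * ν x a)
  walks-suc n a b =
    trans (Σ-allVecs cs n (λ r → ⟦ walkᵇ a r b ⟧))
      (Σ-cong cs (λ {x} _ →
        trans (Σ-cong (allVecs cs n) (λ {r} _ → ⟦∧⟧ (walkᵇ x r b) (x ≢ᵇ a)))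
              (Σ-*ʳ (allVecs cs n) (λ r → ⟦ walkᵇ x r b ⟧) (ν x a))))

  walks-count : (n : ℕ) {a b : ℤ} → a ∈ cs → b ∈ cs →
                walks n a b ≡ alt (q - + 1) n - sgn n * δ a b
  walks-count zero {a} {b} _ _ = begin
    ν b a + + 0          ≡⟨ ℤP.+-identityʳ (ν b a) ⟩
    ν b a                ≡⟨ ν≡1-δ b a ⟩
    + 1 - δ b a          ≡⟨ cong (_-_ (+ 1)) (trans (δ-sym b a) (sym (ℤP.*-identityˡ (δ a b)))) ⟩
    + 1 - + 1 * δ a b    ∎
  walks-count (suc n) {a} {b} a∈cs b∈cs = begin
    walks (suc n) a b
      ≡⟨ walks-suc n a b ⟩
    Σ⟨ cs ⟩ (λ x → walks n x b * ν x a)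
      ≡⟨ Σ-cong cs (λ {x} x∈cs → cong (_* ν x a) (walks-count n x∈cs b∈cs)) ⟩
    Σ⟨ cs ⟩ (λ x → (T - s * δ x b) * ν x a)
      ≡⟨ Σ-ν distinct a∈cs (λ x → T - s * δ x b) ⟩
    Σ⟨ cs ⟩ (λ x → T - s * δ x b) - (T - s * δ a b)
      ≡⟨ cong (λ z → z - (T - s * δ a b)) into-b ⟩
    (q * T - s) - (T - s * δ a b)
      ≡⟨ regroup q T s (δ a b) ⟩
    (T * (q - + 1) + -[1+ 0 ] * s) - -[1+ 0 ] * s * δ a b
      ≡⟨ cong (λ z → z - sgn (suc n) * δ a b) (sym (alt-suc (q - + 1) n)) ⟩
    alt (q - + 1) (suc n) - sgn (suc n) * δ a b ∎
    where
    T = alt (q - + 1) n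
    s = sgn n
    regroup : ∀ q T s d → (q * T - s) - (T - s * d) ≡ (T * (q - + 1) + -[1+ 0 ] * s) - -[1+ 0 ] * s * d
    regroup = ℤSolver.solve-∀
    into-b : Σ⟨ cs ⟩ (λ x → T - s * δ x b) ≡ q * T - s
    into-b = begin
      Σ⟨ cs ⟩ (λ x → T - s * δ x b)          ≡⟨ Σ-- cs (λ _ → T) (λ x → s * δ x b) ⟩
      Σ⟨ cs ⟩ (λ _ → T) - Σ⟨ cs ⟩ (λ x → s * δ x b) ≡⟨ cong₂ _-_ (Σ-const cs T) (Σ-δ distinct b∈cs (λ _ → s)) ⟩
      q * T - s                               ∎

  walks-between-ends : (n : ℕ) →
    Σ⟨ cs ⟩ (λ a → Σ⟨ cs ⟩ (λ b → walks n a b * ⟦ endsᵇ a b ⟧))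
      ≡ alt (q - + 1) n * Σ⟨ cs ⟩ (λ a → Σ⟨ cs ⟩ (λ b → ⟦ endsᵇ a b ⟧))
  walks-between-ends n = begin
    Σ⟨ cs ⟩ (λ a → Σ⟨ cs ⟩ (λ b → walks n a b * ⟦ endsᵇ a b ⟧))
      ≡⟨ Σ-cong cs (λ a∈cs → Σ-cong cs (λ b∈cs → admissible a∈cs b∈cs)) ⟩
    Σ⟨ cs ⟩ (λ a → Σ⟨ cs ⟩ (λ b → T * ⟦ endsᵇ a b ⟧))
      ≡⟨ Σ-cong cs (λ {a} _ → Σ-*ˡ cs T (λ b → ⟦ endsᵇ a b ⟧)) ⟩
    Σ⟨ cs ⟩ (λ a → T * Σ⟨ cs ⟩ (λ b → ⟦ endsᵇ a b ⟧))
      ≡⟨ Σ-*ˡ cs T (λ a → Σ⟨ cs ⟩ (λ b → ⟦ endsᵇ a b ⟧)) ⟩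
    T * Σ⟨ cs ⟩ (λ a → Σ⟨ cs ⟩ (λ b → ⟦ endsᵇ a b ⟧)) ∎
    where
    T = alt (q - + 1) n
    expand : ∀ T s d e → (T - s * d) * e ≡ T * e - s * (d * e)
    expand = ℤSolver.solve-∀
    admissible : ∀ {a b} → a ∈ cs → b ∈ cs → walks n a b * ⟦ endsᵇ a b ⟧ ≡ T * ⟦ endsᵇ a b ⟧
    admissible {a} {b} a∈cs b∈cs = begin
      walks n a b * ⟦ endsᵇ a b ⟧                 ≡⟨ cong (_* ⟦ endsᵇ a b ⟧) (walks-count n a∈cs b∈cs) ⟩
      (T - sgn n * δ a b) * ⟦ endsᵇ a b ⟧         ≡⟨ expand T (sgn n) (δ a b) ⟦ endsᵇ a b ⟧ ⟩
      T * ⟦ endsᵇ a b ⟧ - sgn n * (δ a b * ⟦ endsᵇ a b ⟧)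
        ≡⟨ cong (λ z → T * ⟦ endsᵇ a b ⟧ - sgn n * z) (δ-ends a b) ⟩
      T * ⟦ endsᵇ a b ⟧ - sgn n * + 0             ≡⟨ cong (λ z → T * ⟦ endsᵇ a b ⟧ - z) (ℤP.*-zeroʳ (sgn n)) ⟩
      T * ⟦ endsᵇ a b ⟧ - + 0                     ≡⟨ ℤP.+-identityʳ _ ⟩
      T * ⟦ endsᵇ a b ⟧                           ∎

  -- For a palette containing 0 and closed under negation there are
  -- (q - 1)² admissible end pairs: for each a, b avoids -a and a, which
  -- coincide exactly when a = 0.
  ends-total : + 0 ∈ cs → (∀ {a} → a ∈ cs → - a ∈ cs) →
    Σ⟨ cs ⟩ (λ a → Σ⟨ cs ⟩ (λ b → ⟦ endsᵇ a b ⟧)) ≡ (q - + 1) * (q - + 1)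
  ends-total 0∈cs neg∈cs = begin
    Σ⟨ cs ⟩ (λ a → Σ⟨ cs ⟩ (λ b → ⟦ endsᵇ a b ⟧))
      ≡⟨ Σ-cong cs (λ {a} a∈cs →
           trans (Σ-cong cs (λ {b} _ → ⟦∧⟧ (b ≢ᵇ - a) (b ≢ᵇ a)))
                 (Σ-ν distinct a∈cs (λ b → ν b (- a)))) ⟩
    Σ⟨ cs ⟩ (λ a → Σ⟨ cs ⟩ (λ b → ν b (- a)) - ν a (- a))
      ≡⟨ Σ-cong cs (λ {a} a∈cs → cong₂ _-_ (ν-count distinct (neg∈cs a∈cs)) (ν-self-neg a)) ⟩
    Σ⟨ cs ⟩ (λ a → (q - + 1) - ν a (+ 0))
      ≡⟨ Σ-- cs (λ _ → q - + 1) (λ a → ν a (+ 0)) ⟩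
    Σ⟨ cs ⟩ (λ _ → q - + 1) - Σ⟨ cs ⟩ (λ a → ν a (+ 0))
      ≡⟨ cong₂ _-_ (Σ-const cs (q - + 1)) (ν-count distinct 0∈cs) ⟩
    q * (q - + 1) - (q - + 1)
      ≡⟨ factor q ⟩
    (q - + 1) * (q - + 1) ∎
    where
    factor : ∀ q → q * (q - + 1) - (q - + 1) ≡ (q - + 1) * (q - + 1)
    factor = ℤSolver.solve-∀

respectsᵇ : {n : ℕ} → Vec ℤ n → Edge n → Bool
respectsᵇ c e = lookup c (Edge.tgt e) ≢ᵇ act (Edge.sgn e) (lookup c (Edge.src e))

path-respects : {n : ℕ} (c : Vec ℤ n) (vs : List (Fin n)) →
  foldr (λ e ok → ok ∧ respectsᵇ c e) true (pathEdges vs) ≡ pathᵇ (map (lookup c) vs)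
path-respects c []           = refl
path-respects c (x ∷ [])     = refl
path-respects c (x ∷ y ∷ ys) = cong (_∧ respectsᵇ c (edge x y pos)) (path-respects c (y ∷ ys))

tabulate-lookup-vec : {n : ℕ} (r : Vec A n) → tabulate (lookup r) ≡ toList r
tabulate-lookup-vec []      = refl
tabulate-lookup-vec (x ∷ r) = cong (x ∷_) (tabulate-lookup-vec r)

interior-colours : {n : ℕ} (a b : ℤ) (r : Vec ℤ n) →
  map (lookup (a ∷ b ∷ r)) (map (λ i → suc (suc i)) (allFin n)) ≡ toList r
interior-colours a b r = begin
  map (lookup (a ∷ b ∷ r)) (map (λ i → suc (suc i)) (allFin _))
    ≡⟨ cong (map (lookup (a ∷ b ∷ r))) (ListP.map-tabulate (λ i → i) (λ i → suc (suc i))) ⟩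
  map (lookup (a ∷ b ∷ r)) (tabulate (λ i → suc (suc i)))
    ≡⟨ ListP.map-tabulate (λ i → suc (suc i)) (lookup (a ∷ b ∷ r)) ⟩
  tabulate (lookup r)
    ≡⟨ tabulate-lookup-vec r ⟩
  toList r ∎

proper-B¹ : (j : ℕ) (a b : ℤ) (r : Vec ℤ (suc j)) →
            properᵇ (B¹ (suc j)) (a ∷ b ∷ r) ≡ walkᵇ a r b ∧ endsᵇ a b
proper-B¹ j a b r = begin
  (onPath ∧ (b ≢ᵇ - a)) ∧ (b ≢ᵇ a)
    ≡⟨ ∧-assoc onPath (b ≢ᵇ - a) (b ≢ᵇ a) ⟩
  onPath ∧ endsᵇ a b
    ≡⟨ cong (_∧ endsᵇ a b) (path-respects c vs) ⟩
  pathᵇ (a ∷ map (lookup c) (interior ++ suc zero ∷ [])) ∧ endsᵇ a b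
    ≡⟨ cong (λ xs → pathᵇ (a ∷ xs) ∧ endsᵇ a b) (ListP.map-++ (lookup c) interior (suc zero ∷ [])) ⟩
  pathᵇ (a ∷ map (lookup c) interior ++ b ∷ []) ∧ endsᵇ a b
    ≡⟨ cong (λ xs → pathᵇ (a ∷ xs ++ b ∷ []) ∧ endsᵇ a b) (interior-colours a b r) ⟩
  walkᵇ a r b ∧ endsᵇ a b ∎
  where
  c = a ∷ b ∷ r
  interior = map (λ i → suc (suc i)) (allFin (suc j))
  vs = zero ∷ interior ++ suc zero ∷ []
  onPath = foldr (λ e ok → ok ∧ respectsᵇ c e) true (pathEdges vs)

module Colours (k : ℕ) where

  shift : ℕ → ℤ
  shift i = + i - + k

  shift-injective : {i j : ℕ} → shift i ≡ shift j → i ≡ j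
  shift-injective {i} {j} eq = ℤP.+-injective (begin
    + i                 ≡⟨ unshift (+ i) (+ k) ⟩
    shift i + + k       ≡⟨ cong (_+ + k) eq ⟩
    shift j + + k       ≡⟨ sym (unshift (+ j) (+ k)) ⟩
    + j                 ∎)
    where
    unshift : ∀ x y → x ≡ (x - y) + y
    unshift = ℤSolver.solve-∀

  shift-reflect : {i : ℕ} → i ≤ 2 ℕ.* k → shift (2 ℕ.* k ∸ i) ≡ - shift i
  shift-reflect {i} i≤2k = begin
    + (2 ℕ.* k ∸ i) - + k            ≡⟨ cong (_- + k) (sym (ℤP.⊖-≥ i≤2k)) ⟩
    (2 ℕ.* k ⊖ i) - + k             ≡⟨ cong (_- + k) (sym (ℤP.m-n≡m⊖n (2 ℕ.* k) i)) ⟩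
    (+ (2 ℕ.* k) - + i) - + k        ≡⟨ cong (λ x → (x - + i) - + k) (ℤP.pos-* 2 k) ⟩
    (+ 2 * + k - + i) - + k          ≡⟨ negate (+ k) (+ i) ⟩
    - (+ i - + k)                    ∎
    where
    negate : ∀ x y → (+ 2 * x - y) - x ≡ - (y - x)
    negate = ℤSolver.solve-∀

  colours-distinct : Unique (colours k)
  colours-distinct = UniqueP.map⁺ shift-injective (UniqueP.upTo⁺ (suc (2 ℕ.* k)))

  colours-size : + length (colours k) - + 1 ≡ + (2 ℕ.* k)
  colours-size = cong (λ n → + n - + 1)
    (trans (ListP.length-map shift (upTo (suc (2 ℕ.* k)))) (ListP.length-upTo (suc (2 ℕ.* k))))

  0∈colours : + 0 ∈ colours k
  0∈colours = subst (_∈ colours k) (ℤP.+-inverseʳ (+ k))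
                (∈-map⁺ shift (∈-upTo⁺ (s≤s (ℕP.m≤m+n k (k ℕ.+ 0)))))

  neg∈colours : {a : ℤ} → a ∈ colours k → - a ∈ colours k
  neg∈colours a∈ with ∈-map⁻ shift a∈
  ... | i , i∈ , refl = subst (_∈ colours k) (shift-reflect (ℕP.≤-pred (∈-upTo⁻ i∈)))
                          (∈-map⁺ shift (∈-upTo⁺ (s≤s (ℕP.m∸n≤m (2 ℕ.* k) i))))

  open Palette (colours k) colours-distinct

  χ-C2⁻-ends : + χ[ C2⁻ ]⟨2* k +1⟩ ≡ Σ⟨ colours k ⟩ (λ a → Σ⟨ colours k ⟩ (λ b → ⟦ endsᵇ a b ⟧))
  χ-C2⁻-ends = trans (count-by-first-two (colours k) (properᵇ C2⁻))
    (Σ-cong (colours k) (λ {a} _ →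
      Σ-cong (colours k) {g = λ b → ⟦ endsᵇ a b ⟧} (λ {b} _ → ℤP.+-identityʳ ⟦ endsᵇ a b ⟧)))

  χ-C2⁻ : + χ[ C2⁻ ]⟨2* k +1⟩ ≡ (+ (2 ℕ.* k)) ^ 2
  χ-C2⁻ = begin
    + χ[ C2⁻ ]⟨2* k +1⟩                                       ≡⟨ χ-C2⁻-ends ⟩
    Σ⟨ colours k ⟩ (λ a → Σ⟨ colours k ⟩ (λ b → ⟦ endsᵇ a b ⟧)) ≡⟨ ends-total 0∈colours neg∈colours ⟩
    (q - + 1) * (q - + 1)                                     ≡⟨ cong (λ p → p * p) colours-size ⟩
    + (2 ℕ.* k) * + (2 ℕ.* k)                                 ≡⟨ cong (+ (2 ℕ.* k) *_) (sym (ℤP.*-identityʳ _)) ⟩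
    (+ (2 ℕ.* k)) ^ 2                                         ∎

  -- χ(B¹) factors through χ(C₂⁻): every admissible end pair extends in
  -- alt (2k) n ways.
  χ-B¹ : (n : ℕ) → + χ[ B¹ n ]⟨2* k +1⟩ ≡ alt (+ (2 ℕ.* k)) n * + χ[ C2⁻ ]⟨2* k +1⟩
  χ-B¹ zero    = sym (ℤP.*-identityˡ _)
  χ-B¹ (suc j) = begin
    + χ[ B¹ (suc j) ]⟨2* k +1⟩
      ≡⟨ count-by-first-two (colours k) (properᵇ (B¹ (suc j))) ⟩
    Σ⟨ colours k ⟩ (λ a → Σ⟨ colours k ⟩ (λ b →
      Σ⟨ allVecs (colours k) (suc j) ⟩ (λ r → ⟦ properᵇ (B¹ (suc j)) (a ∷ b ∷ r) ⟧)))
      ≡⟨ Σ-cong (colours k) (λ {a} _ → Σ-cong (colours k) (λ {b} _ → split-ends a b)) ⟩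
    Σ⟨ colours k ⟩ (λ a → Σ⟨ colours k ⟩ (λ b → walks (suc j) a b * ⟦ endsᵇ a b ⟧))
      ≡⟨ walks-between-ends (suc j) ⟩
    alt (q - + 1) (suc j) * Σ⟨ colours k ⟩ (λ a → Σ⟨ colours k ⟩ (λ b → ⟦ endsᵇ a b ⟧))
      ≡⟨ cong₂ (λ p χ → alt p (suc j) * χ) colours-size (sym χ-C2⁻-ends) ⟩
    alt (+ (2 ℕ.* k)) (suc j) * + χ[ C2⁻ ]⟨2* k +1⟩ ∎
    where
    split-ends : ∀ a b →
      Σ⟨ allVecs (colours k) (suc j) ⟩ (λ r → ⟦ properᵇ (B¹ (suc j)) (a ∷ b ∷ r) ⟧)
        ≡ walks (suc j) a b * ⟦ endsᵇ a b ⟧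
    split-ends a b =
      trans (Σ-cong (allVecs (colours k) (suc j))
               (λ {r} _ → trans (cong ⟦_⟧ (proper-B¹ j a b r)) (⟦∧⟧ (walkᵇ a r b) (endsᵇ a b))))
            (Σ-*ʳ (allVecs (colours k) (suc j)) (λ r → ⟦ walkᵇ a r b ⟧) ⟦ endsᵇ a b ⟧)

lemma6p4 : (m k : ℕ) → 2 ≤ m → 1 ≤ k →
    ((+ χ[ B¹ (m ∸ 2) ]⟨2* k +1⟩)
      ≡ (Σ[i≤ m ∸ 2 ] (λ i → (-[1+ 0 ] ^ i) * ((+ (2 Data.Nat.* k)) ^ ((m ∸ 2) ∸ i)))) * (+ χ[ C2⁻ ]⟨2* k +1⟩))
    × ((Σ[i≤ m ∸ 2 ] (λ i → (-[1+ 0 ] ^ i) * ((+ (2 Data.Nat.* k)) ^ ((m ∸ 2) ∸ i)))) * (+ χ[ C2⁻ ]⟨2* k +1⟩)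
      ≡ Σ[i≤ m ∸ 2 ] (λ i → (-[1+ 0 ] ^ i) * ((+ (2 Data.Nat.* k)) ^ (m ∸ i))))
-- Write m = n + 2.
lemma6p4 (suc (suc n)) k (s≤s (s≤s z≤n)) _ =
  χ-B¹ n ,
  trans (cong (alt (+ (2 ℕ.* k)) n *_) χ-C2⁻) (alt-scale (+ (2 ℕ.* k)) n 2)
  where
  open Colours k
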